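{- Let $F$ be a tract and $\varphi:\mathcal T_n\cup\mathcal A_n\to F$ a restricted Grassmann--Plücker function. For each hyper-transversal $S$ let $X_S\in F^{[n]\cup[n]^*}$ be given by $X_S(i)=(-1)^{|S<i|}\varphi(S\setminus\{i\})$ for $i\in S$ and $X_S(i)=0$ for $i\notin S$, and let $\mathcal C=\{cX_S: c\in F^\times,\ S\text{ a hyper-transversal},\ X_S\ne0\}$. Then $\{\mathrm{supp}(X):X\in\mathcal C\}$ is the set of circuits of the orthogonal matroid $([n]\cup[n]^*,\{B\in\mathcal T_n:\varphi(B)\neq0\})$.
   Context: Tract: monoid $F=F^\times\sqcup\{0\}$ with null set $N_F$ of formal sums, $F\cap N_F=\{0\}$, unique $-1$ with $1+(-1)\in N_F$, $N_F$ closed under $F^\times$-scaling. Notation: $[n]^*=\{1^*,\dots,n^*\}$; order $1<1^*<\dots<n<n^*$; $|X<i|$ = number of elements of $X$ smaller than $i$; $[P]$ indicator. $\mathcal T_n$: transversals (exactly one of $i,i^*$ for each $i$); $\mathcal T_n^\sigma$: $|T\cap[n]^*|\equiv\sigma\pmod2$; $\mathcal A_n$: $n$-subsets containing exactly one pair $\{i,i^*\}$; hyper-/hypo-transversal: transversal with one element added/removed; subtransversal: subset of a transversal. Restricted Grassmann--Plücker function: $\varphi:\mathcal T_n\cup\mathcal A_n\to F$, not identically zero, with (rGP2) $\sum_{i\in S\setminus S'}(-1)^{|S\triangle S'<i|}\varphi(S\setminus\{i\})\varphi(S'\cup\{i\})\in N_F$ for every hyper-transversal $S$ and hypo-transversal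 $S'$; (rGP3) some $\sigma\in\{0,1\}$ with $\varphi=0$ on $\mathcal T_n^{1-\sigma}$; (rGP4) $\varphi((B\setminus\{i,i^*\})\cup\{j,j^*\})=(-1)^{[i\in B]+[j\in B]}\varphi((B\cup\{i,i^*\})\setminus\{j,j^*\})$ for $B\in\mathcal T_n^\sigma$, distinct $i,j\in[n]$. Orthogonal matroid $([n]\cup[n]^*,\mathcal B)$, $\mathcal B\subseteq\mathcal T_n$: for $B_1,B_2\in\mathcal B$ and $\{i,i^*\}\subseteq B_1\triangle B_2$ there is $\{j,j^*\}\subseteq(B_1\triangle B_2)\setminus\{i,i^*\}$ with $B_k\triangle\{i,i^*,j,j^*\}\in\mathcal B$ ($k=1,2$). Its circuits are the minimal subtransversals contained in no element of $\mathcal B$. -}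

module Defs where

open import Data.Bool using (Bool; true; false; not; _∧_; _xor_; if_then_else_)
open import Data.Nat using (ℕ; zero; suc; _+_; _*_; _<ᵇ_)
open import Data.Fin using (Fin; toℕ)
open import Data.List using (List; []; _∷_; map; concatMap; allFin; length; filterᵇ; foldr)
open import Data.List.Relation.Binary.Permutation.Propositional using (_↭_)
open import Data.Maybe using (Maybe; just; nothing)
open import Data.Vec using (Vec; lookup; updateAt)
open import Data.Product using (Σ; _×_; _,_; proj₁; proj₂; ∃; ∃-syntax)
open import Data.Empty using (⊥)
open import Relation.Nullary using (¬_)
open import Relation.Binary.PropositionalEquality using (_≡_; _≢_)
open import Function.Bundles using (_⇔_)
import Data.Sum

-- F = F^× ⊔ {0} is modelled as  Maybe G  (nothing = 0), where
-- G = F^× is an abelian group (with propositional equality).  Formal sums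
-- of elements of F^× (elements of ℕ[F^×]) are lists of units, taken up to
-- permutation; N is the null set N_F.

record Tract : Set₁ where
  field
    G      : Set
    _·_    : G → G → G
    one    : G
    inv    : G → G
    ·-assoc : ∀ x y z → (x · y) · z ≡ x · (y · z)
    ·-comm  : ∀ x y → x · y ≡ y · x
    ·-idˡ   : ∀ x → one · x ≡ x
    ·-invˡ  : ∀ x → inv x · x ≡ one
    N       : List G → Set
    -- N is a set of formal sums, i.e. invariant under reordering
    N-perm  : ∀ {xs ys} → xs ↭ ys → N xs → N ys
    -- F ∩ N_F = {0}
    N-zero  : N []
    N-unit  : ∀ x → ¬ N (x ∷ [])
    minus   : G
    minus-null   : N (one ∷ minus ∷ [])
    minus-unique : ∀ y → N (one ∷ y ∷ []) → y ≡ minus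
    N-scale : ∀ c xs → N xs → N (map (c ·_) xs)

module _ (T : Tract) where
  open Tract T

  F : Set
  F = Maybe G

  0F : F
  0F = nothing

  1F : F
  1F = just one

  _⊙_ : F → F → F
  just x ⊙ just y = just (x · y)
  _ ⊙ _ = nothing

  sgn : ℕ → F
  sgn zero = 1F
  sgn (suc k) = just minus ⊙ sgn k

  formalSum : List F → List G
  formalSum [] = []
  formalSum (nothing ∷ xs) = formalSum xs
  formalSum (just x ∷ xs) = x ∷ formalSum xs

  InN : List F → Set
  InN xs = N (formalSum xs)

-- The ground set [n] ∪ [n]^*.  (i , false) is i, (i , true) is i^*.
-- The order 1 < 1^* < 2 < 2^* < ... is given by rank.

E : ℕ → Set
E n = Fin n × Bool

rank : ∀ {n} → E n → ℕ
rank (i , b) = 2 * toℕ i + (if b then 1 else 0)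

allE : ∀ n → List (E n)
allE n = concatMap (λ i → (i , false) ∷ (i , true) ∷ []) (allFin n)

-- subsets of [n] ∪ [n]^*: for each i, (i ∈ S , i^* ∈ S)
Sub : ℕ → Set
Sub n = Vec (Bool × Bool) n

mem : ∀ {n} → Sub n → E n → Bool
mem S (i , false) = proj₁ (lookup S i)
mem S (i , true)  = proj₂ (lookup S i)

_∈ₛ_ : ∀ {n} → E n → Sub n → Set
e ∈ₛ S = mem S e ≡ true

_⊆ₛ_ : ∀ {n} → Sub n → Sub n → Set
C ⊆ₛ D = ∀ e → e ∈ₛ C → e ∈ₛ D

setMem : ∀ {n} → E n → Bool → Sub n → Sub n
setMem (i , false) v S = updateAt S i (λ p → v , proj₂ p)
setMem (i , true)  v S = updateAt S i (λ p → proj₁ p , v)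

del : ∀ {n} → Sub n → E n → Sub n
del S e = setMem e false S

ins : ∀ {n} → Sub n → E n → Sub n
ins S e = setMem e true S

setPair : ∀ {n} → Fin n → Bool → Sub n → Sub n
setPair i v S = updateAt S i (λ _ → v , v)

countᵇ : ∀ {n} → (E n → Bool) → ℕ
countᵇ {n} p = length (filterᵇ p (allE n))

card : ∀ {n} → Sub n → ℕ
card S = countᵇ (mem S)

countBelow : ∀ {n} → Sub n → E n → ℕ
countBelow X e = countᵇ (λ x → mem X x ∧ (rank x <ᵇ rank e))

symDiff : ∀ {n} → Sub n → Sub n → Sub n
symDiff Data.Vec.[] Data.Vec.[] = Data.Vec.[]
symDiff ((a , b) Data.Vec.∷ S) ((c , d) Data.Vec.∷ S') = (a xor c , b xor d) Data.Vec.∷ symDiff S S'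

starParity : ∀ {n} → Sub n → Bool
starParity Data.Vec.[] = false
starParity ((_ , b) Data.Vec.∷ S) = b xor starParity S

ExactlyOne : Bool × Bool → Set
ExactlyOne (a , b) = a ≡ not b

IsTransversal : ∀ {n} → Sub n → Set
IsTransversal S = ∀ i → ExactlyOne (lookup S i)

IsHyperTransversal : ∀ {n} → Sub n → Set
IsHyperTransversal {n} S =
  Σ (Fin n) λ j → lookup S j ≡ (true , true) × (∀ i → i ≢ j → ExactlyOne (lookup S i))

IsHypoTransversal : ∀ {n} → Sub n → Set
IsHypoTransversal {n} S =
  Σ (Fin n) λ j → lookup S j ≡ (false , false) × (∀ i → i ≢ j → ExactlyOne (lookup S i))

IsSubtransversal : ∀ {n} → Sub n → Set
IsSubtransversal {n} C = Σ (Sub n) λ T → IsTransversal T × C ⊆ₛ T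

InA : ∀ {n} → Sub n → Set
InA {n} A = card A ≡ n ×
  Σ (Fin n) λ j → lookup A j ≡ (true , true) × (∀ i → lookup A i ≡ (true , true) → i ≡ j)

-- restricted Grassmann–Plücker functions.  φ is given on all subsets,
-- but only its values on 𝒯_n ∪ 𝒜_n enter the axioms and the theorem.

module _ (T : Tract) where
  open Tract T

  rGP2-sum : ∀ {n} → (Sub n → F T) → Sub n → Sub n → List (F T)
  rGP2-sum {n} φ S S' =
    map (λ i → _⊙_ T (sgn T (countBelow (symDiff S S') i))
                     (_⊙_ T (φ (del S i)) (φ (ins S' i))))
        (filterᵇ (λ i → mem S i ∧ not (mem S' i)) (allE n))

  record IsRestrictedGP {n : ℕ} (φ : Sub n → F T) : Set where
    field
      nonzero : Σ (Sub n) λ S → (IsTransversal S Data.Sum.⊎ InA S) × φ S ≢ nothing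
      rGP2 : ∀ S S' → IsHyperTransversal S → IsHypoTransversal S' → InN T (rGP2-sum φ S S')
      rGP34 : Σ Bool λ σ →
        (∀ B → IsTransversal B → starParity B ≢ σ → φ B ≡ nothing) ×
        (∀ B → IsTransversal B → starParity B ≡ σ → ∀ i j → i ≢ j →
           φ (setPair j true (setPair i false B))
             ≡ _⊙_ T (sgn T ((if proj₁ (lookup B i) then 1 else 0) + (if proj₁ (lookup B j) then 1 else 0)))
                     (φ (setPair j false (setPair i true B))))

  Xvec : ∀ {n} → (Sub n → F T) → Sub n → E n → F T
  Xvec φ S e = if mem S e then _⊙_ T (sgn T (countBelow S e)) (φ (del S e)) else nothing

  InCircuitSet : ∀ {n} → (Sub n → F T) → (E n → F T) → Set
  InCircuitSet {n} φ X = Σ G λ c → Σ (Sub n) λ S →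
    IsHyperTransversal S × ¬ (∀ e → Xvec φ S e ≡ nothing) × (∀ e → X e ≡ _⊙_ T (just c) (Xvec φ S e))

  IsSupport : ∀ {n} → (E n → F T) → Sub n → Set
  IsSupport X C = ∀ e → (e ∈ₛ C ⇔ X e ≢ nothing)

  IsBasis : ∀ {n} → (Sub n → F T) → Sub n → Set
  IsBasis φ B = IsTransversal B × φ B ≢ nothing

IsCircuit : ∀ {n} → (Sub n → Set) → Sub n → Set
IsCircuit {n} Basis C =
  IsSubtransversal C ×
  (∀ B → Basis B → ¬ (C ⊆ₛ B)) ×
  (∀ D → D ⊆ₛ C → D ≢ C → IsSubtransversal D → ¬ (∀ B → Basis B → ¬ (D ⊆ₛ B)))

-- For a hyper-transversal S the support of X_S is {x ∈ S : φ(S ∖ x) ≠ 0}, and everything follows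
-- from instances of rGP2 in which all but one or two terms vanish.  With S′ = B ∖ x for a basis
-- B ⊇ supp X_S only the x-term survives, so supp X_S lies in no basis.  For S = B ∪ {e} with B a
-- basis and f ∈ B in another pair, a suitable hypo-transversal leaves three terms, indexed by e, e*
-- and f; rGP3 kills the e*-term and rGP4 ties the f-term to φ(S ∖ f), so f ∈ supp X_S forces B with
-- the pairs of e and f switched to be a basis as well.  Hence supp X_S ∖ {f} lies in a basis for
-- every f: supp X_S is the fundamental circuit of e over B, and every circuit C with C ∖ {e} inside
-- a basis B equals it.  The same three-term relation shows that every hyper-transversal S with
-- X_S ≠ 0 is B ∪ {e} for a basis B.

module Submission where

open import Defs
open import Data.Bool using (Bool; true; false; not; _∧_; if_then_else_)
open import Data.Bool.Properties using (not-¬; ⇔→≡; not-involutive; ¬-not; not-distribˡ-xor; not-distribʳ-xor) renaming (_≟_ to _≟ᵇ_)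
open import Data.Empty using (⊥; ⊥-elim)
open import Data.Fin using (Fin; zero; suc)
open import Data.Fin.Properties using (any?; all?) renaming (_≟_ to _≟ᶠ_)
open import Data.List using (List; []; _∷_; _++_; map; concatMap; filterᵇ; tabulate; allFin; length)
open import Data.List.Properties using (++-identityʳ; concatMap-map; map-concatMap; map-tabulate)
open import Data.Maybe using (Maybe; just; nothing; is-just)
open import Data.Nat using (ℕ; zero; suc; _+_; _≤_; z≤n; s≤s)
open import Data.Nat.Properties using (m≤n⇒m≤1+n; suc-injective; 1+n≰n; +-suc)
open import Data.Product using (Σ; _×_; _,_; proj₁; proj₂; swap)
open import Data.Product.Properties using (≡-dec)
open import Data.Sum using (_⊎_; inj₁; inj₂; [_,_]′)
import Data.Vec as Vec
open import Data.Vec using (lookup; updateAt) renaming ([] to []ᵥ; _∷_ to _∷ᵥ_)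
open import Data.Vec.Properties
  using (lookup∘tabulate; lookup∘updateAt; lookup∘updateAt′; tabulate∘lookup; tabulate-cong; updateAt-cong-local; updateAt-commutes; updateAt-updateAt)
open import Function using (id; _∘_)
open import Function.Bundles using (_⇔_; mk⇔; module Equivalence)
open import Relation.Binary.PropositionalEquality using (_≡_; _≢_; refl; sym; trans; cong; cong₂; subst; module ≡-Reasoning)
open import Relation.Nullary using (Dec; yes; no; ¬_)
open import Relation.Nullary.Decidable using (map′; _⊎-dec_; _×-dec_; _→-dec_)

private variable
  n : ℕ

true≢false : true ≢ false
true≢false ()

∧-true : ∀ {a b} → a ∧ b ≡ true → a ≡ true × b ≡ true
∧-true {true}  {true}  _ = refl , refl
∧-true {true}  {false} ()
∧-true {false} ()

is-just≡false : ∀ {A : Set} {x : Maybe A} → is-just x ≡ false → x ≡ nothing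
is-just≡false {x = nothing} _ = refl

-- The ground set [n] ∪ [n]*

opp : E n → E n
opp (i , b) = i , not b

opp-≢ : (x : E n) → x ≢ opp x
opp-≢ (_ , false) ()
opp-≢ (_ , true) ()

opp-≢′ : (x : E n) → opp x ≢ x
opp-≢′ x = opp-≢ x ∘ sym

pair-cases : (x e : E n) → x ≡ e ⊎ x ≡ opp e ⊎ proj₁ x ≢ proj₁ e
pair-cases (i , c) (j , b) with i ≟ᶠ j
... | no i≢j = inj₂ (inj₂ i≢j)
... | yes refl with c ≟ᵇ b
...   | yes refl = inj₁ refl
...   | no c≢b = inj₂ (inj₁ (cong (i ,_) (¬-not c≢b)))

_≟ₑ_ : (x y : E n) → Dec (x ≡ y)
_≟ₑ_ = ≡-dec _≟ᶠ_ _≟ᵇ_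

sucₑ : E n → E (suc n)
sucₑ (i , b) = suc i , b

allE-suc : ∀ n → allE (suc n) ≡ (zero , false) ∷ (zero , true) ∷ map sucₑ (allE n)
allE-suc n = cong (λ xs → (zero , false) ∷ (zero , true) ∷ xs) (begin
  concatMap pair (tabulate suc)               ≡⟨ cong (concatMap pair) (map-tabulate id suc) ⟨
  concatMap pair (map suc (allFin n))         ≡⟨ concatMap-map pair suc (allFin n) ⟩
  concatMap (map sucₑ ∘ pair) (allFin n)      ≡⟨ map-concatMap sucₑ pair (allFin n) ⟨
  map sucₑ (allE n)                           ∎)
  where
  open ≡-Reasoning
  pair : ∀ {m} → Fin m → List (E m)
  pair i = (i , false) ∷ (i , true) ∷ []

concatMap-[] : {A C : Set} (h : A → List C) (xs : List A) → (∀ x → h x ≡ []) → concatMap h xs ≡ []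
concatMap-[] h [] h≡[] = refl
concatMap-[] h (x ∷ xs) h≡[] rewrite h≡[] x = concatMap-[] h xs h≡[]

concatMap-allE-single : {C : Set} (h : E n → List C) (e : E n) →
  (∀ x → x ≢ e → h x ≡ []) → concatMap h (allE n) ≡ h e
concatMap-allE-single {zero} h (() , _)
concatMap-allE-single {suc n} h e h≡[] = begin
  concatMap h (allE (suc n))                                                 ≡⟨ cong (concatMap h) (allE-suc n) ⟩
  h (zero , false) ++ h (zero , true) ++ concatMap h (map sucₑ (allE n))
    ≡⟨ cong (λ xs → h (zero , false) ++ h (zero , true) ++ xs) (concatMap-map h sucₑ (allE n)) ⟩
  h (zero , false) ++ h (zero , true) ++ concatMap (h ∘ sucₑ) (allE n)       ≡⟨ split e h≡[] ⟩
  h e                                                                        ∎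
  where
  open ≡-Reasoning
  tail-[] : (∀ i b → h (suc i , b) ≡ []) → concatMap (h ∘ sucₑ) (allE n) ≡ []
  tail-[] h≡[] = concatMap-[] (h ∘ sucₑ) (allE n) λ { (i , b) → h≡[] i b }
  split : ∀ e → (∀ x → x ≢ e → h x ≡ []) → h (zero , false) ++ h (zero , true) ++ concatMap (h ∘ sucₑ) (allE n) ≡ h e
  split (zero , false) h≡[] rewrite h≡[] (zero , true)  (λ ()) | tail-[] (λ i b → h≡[] (suc i , b) (λ ())) = ++-identityʳ _
  split (zero , true)  h≡[] rewrite h≡[] (zero , false) (λ ()) | tail-[] (λ i b → h≡[] (suc i , b) (λ ())) = ++-identityʳ _
  split (suc i , b) h≡[] rewrite h≡[] (zero , false) (λ ()) | h≡[] (zero , true) (λ ()) =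
    concatMap-allE-single (h ∘ sucₑ) (i , b) (λ { (j , c) ne → h≡[] (suc j , c) (λ { refl → ne refl }) })

-- Subsets

_∉ₛ_ : E n → Sub n → Set
x ∉ₛ S = mem S x ≡ false

bit : Bool → Bool × Bool → Bool
bit false = proj₁
bit true  = proj₂

swapPair : Fin n → Sub n → Sub n
swapPair i S = updateAt S i swap

mem-updateAt : ∀ (S : Sub n) i g b → mem (updateAt S i g) (i , b) ≡ bit b (g (lookup S i))
mem-updateAt S i g false = cong proj₁ (lookup∘updateAt i S)
mem-updateAt S i g true  = cong proj₂ (lookup∘updateAt i S)

mem-updateAt-≢ : ∀ (S : Sub n) {i} g x → proj₁ x ≢ i → mem (updateAt S i g) x ≡ mem S x
mem-updateAt-≢ S g (j , false) j≢i = cong proj₁ (lookup∘updateAt′ j _ j≢i S)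
mem-updateAt-≢ S g (j , true)  j≢i = cong proj₂ (lookup∘updateAt′ j _ j≢i S)

mem-setMem-≡ : ∀ (e : E n) v S → mem (setMem e v S) e ≡ v
mem-setMem-≡ (i , false) v S = mem-updateAt S i _ false
mem-setMem-≡ (i , true)  v S = mem-updateAt S i _ true

AgreeOff : Fin n → Sub n → Sub n → Set
AgreeOff p X Y = ∀ x → proj₁ x ≢ p → mem X x ≡ mem Y x

setMem-agree : ∀ (S : Sub n) e {v} → AgreeOff (proj₁ e) (setMem e v S) S
setMem-agree S (_ , false) x x≁e = mem-updateAt-≢ S _ x x≁e
setMem-agree S (_ , true)  x x≁e = mem-updateAt-≢ S _ x x≁e

mem-setMem-opp : ∀ (e : E n) v S → mem (setMem e v S) (opp e) ≡ mem S (opp e)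
mem-setMem-opp (i , false) v S = mem-updateAt S i _ true
mem-setMem-opp (i , true)  v S = mem-updateAt S i _ false

mem-setMem-≢ : ∀ (e x : E n) v S → x ≢ e → mem (setMem e v S) x ≡ mem S x
mem-setMem-≢ e x v S x≢e with pair-cases x e
... | inj₁ x≡e         = ⊥-elim (x≢e x≡e)
... | inj₂ (inj₁ refl) = mem-setMem-opp e v S
... | inj₂ (inj₂ x≁e)  = setMem-agree S e x x≁e

mem-swapPair : ∀ (S : Sub n) i b → mem (swapPair i S) (i , b) ≡ mem S (i , not b)
mem-swapPair S i false = mem-updateAt S i swap false
mem-swapPair S i true  = mem-updateAt S i swap true

mem-setPair : ∀ (S : Sub n) i v b → mem (setPair i v S) (i , b) ≡ v
mem-setPair S i v false = mem-updateAt S i _ false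
mem-setPair S i v true  = mem-updateAt S i _ true

Sub-ext : {S S′ : Sub n} → (∀ x → mem S x ≡ mem S′ x) → S ≡ S′
Sub-ext {S = S} {S′} same = begin
  S                   ≡⟨ tabulate∘lookup S ⟨
  Vec.tabulate (lookup S)  ≡⟨ tabulate-cong (λ i → cong₂ _,_ (same (i , false)) (same (i , true))) ⟩
  Vec.tabulate (lookup S′) ≡⟨ tabulate∘lookup S′ ⟩
  S′                  ∎
  where open ≡-Reasoning

⊆-antisym : ∀ {D Z : Sub n} → D ⊆ₛ Z → Z ⊆ₛ D → D ≡ Z
⊆-antisym D⊆Z Z⊆D = Sub-ext λ x → ⇔→≡ (mk⇔ (D⊆Z x) (Z⊆D x))

del-ins : ∀ (S : Sub n) e → e ∉ₛ S → del (ins S e) e ≡ S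
del-ins S e e∉S = Sub-ext λ x → case x (x ≟ₑ e)
  where
  case : ∀ x → Dec (x ≡ e) → mem (del (ins S e) e) x ≡ mem S x
  case x (yes refl) = trans (mem-setMem-≡ e false _) (sym e∉S)
  case x (no x≢e)   = trans (mem-setMem-≢ e x false _ x≢e) (mem-setMem-≢ e x true S x≢e)

ins-del : ∀ (S : Sub n) e → e ∈ₛ S → ins (del S e) e ≡ S
ins-del S e e∈S = Sub-ext λ x → case x (x ≟ₑ e)
  where
  case : ∀ x → Dec (x ≡ e) → mem (ins (del S e) e) x ≡ mem S x
  case x (yes refl) = trans (mem-setMem-≡ e true _) (sym e∈S)
  case x (no x≢e)   = trans (mem-setMem-≢ e x true _ x≢e) (mem-setMem-≢ e x false S x≢e)

lookup-agree : ∀ {p i} {X Y : Sub n} → AgreeOff p X Y → i ≢ p → lookup X i ≡ lookup Y i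
lookup-agree agree i≢p = cong₂ _,_ (agree (_ , false) i≢p) (agree (_ , true) i≢p)

-- Transversals, hyper- and hypo-transversals

exactlyOne-swap : ∀ {x} → ExactlyOne x → ExactlyOne (swap x)
exactlyOne-swap {a , b} a≡¬b = trans (sym (not-involutive b)) (cong not (sym a≡¬b))

exactlyOne-∉ : (S : Sub n) (e : E n) → e ∉ₛ S → opp e ∈ₛ S → ExactlyOne (lookup S (proj₁ e))
exactlyOne-∉ S (i , false) e∉S oe∈S = trans e∉S (cong not (sym oe∈S))
exactlyOne-∉ S (i , true)  e∉S oe∈S = trans oe∈S (cong not (sym e∉S))

full-pair : (S : Sub n) (e : E n) → e ∈ₛ S → opp e ∈ₛ S → lookup S (proj₁ e) ≡ (true , true)
full-pair S (i , false) e∈S oe∈S = cong₂ _,_ e∈S oe∈S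
full-pair S (i , true)  e∈S oe∈S = cong₂ _,_ oe∈S e∈S

empty-pair : (S : Sub n) (e : E n) → e ∉ₛ S → opp e ∉ₛ S → lookup S (proj₁ e) ≡ (false , false)
empty-pair S (i , false) e∉S oe∉S = cong₂ _,_ e∉S oe∉S
empty-pair S (i , true)  e∉S oe∉S = cong₂ _,_ oe∉S e∉S

mem-full : ∀ (S : Sub n) {p} → lookup S p ≡ (true , true) → ∀ b → (p , b) ∈ₛ S
mem-full S full false = cong proj₁ full
mem-full S full true  = cong proj₂ full

mem-opp : ∀ (B : Sub n) x → IsTransversal B → mem B (opp x) ≡ not (mem B x)
mem-opp B (i , false) tB = trans (sym (not-involutive _)) (cong not (sym (tB i)))
mem-opp B (i , true)  tB = tB i

∉⇒opp∈ : ∀ (B : Sub n) x → IsTransversal B → x ∉ₛ B → opp x ∈ₛ B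
∉⇒opp∈ B x tB x∉B = trans (mem-opp B x tB) (cong not x∉B)

∈⇒opp∉ : ∀ (B : Sub n) x → IsTransversal B → x ∈ₛ B → opp x ∉ₛ B
∈⇒opp∉ B x tB x∈B = trans (mem-opp B x tB) (cong not x∈B)

subtransversal-opp : ∀ (C : Sub n) x → IsSubtransversal C → x ∈ₛ C → opp x ∉ₛ C
subtransversal-opp C x (B , tB , C⊆B) x∈C =
  ¬-not λ ox∈C → true≢false (trans (sym (C⊆B (opp x) ox∈C)) (∈⇒opp∉ B x tB (C⊆B x x∈C)))

ins-hyper : ∀ (B : Sub n) e → IsTransversal B → e ∉ₛ B → IsHyperTransversal (ins B e)
ins-hyper B e tB e∉B =
  proj₁ e ,
  full-pair _ e (mem-setMem-≡ e true B) (trans (mem-setMem-≢ e (opp e) true B (opp-≢′ e)) (∉⇒opp∈ B e tB e∉B)) ,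
  λ i i≢p → subst ExactlyOne (sym (lookup-agree (setMem-agree B e) i≢p)) (tB i)

del-hypo : ∀ (B : Sub n) x → IsTransversal B → x ∈ₛ B → IsHypoTransversal (del B x)
del-hypo B x tB x∈B =
  proj₁ x ,
  empty-pair _ x (mem-setMem-≡ x false B) (trans (mem-setMem-≢ x (opp x) false B (opp-≢′ x)) (∈⇒opp∉ B x tB x∈B)) ,
  λ i i≢p → subst ExactlyOne (sym (lookup-agree (setMem-agree B x) i≢p)) (tB i)

del-hyper : ∀ (S : Sub n) (h : IsHyperTransversal S) b → IsTransversal (del S (proj₁ h , b))
del-hyper S (p , full , one) b i with i ≟ᶠ p
... | yes refl = exactlyOne-∉ _ (p , b) (mem-setMem-≡ (p , b) false S)
                   (trans (mem-setMem-≢ (p , b) (p , not b) false S (opp-≢′ (p , b))) (mem-full S full (not b)))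
... | no i≢p   = subst ExactlyOne (sym (lookup-agree (setMem-agree S (p , b)) i≢p)) (one i i≢p)

hyper-ins-del : ∀ (S : Sub n) (hS : IsHyperTransversal S) b → ins (del S (proj₁ hS , b)) (proj₁ hS , b) ≡ S
hyper-ins-del S (p , full , _) b = ins-del S (p , b) (mem-full S full b)

swapPair-transversal : ∀ (B : Sub n) i → IsTransversal B → IsTransversal (swapPair i B)
swapPair-transversal B i tB j with j ≟ᶠ i
... | yes refl = subst ExactlyOne (sym (lookup∘updateAt i B)) (exactlyOne-swap (tB i))
... | no j≢i   = subst ExactlyOne (sym (lookup∘updateAt′ j i j≢i B)) (tB j)

starParity-swapPair : ∀ (B : Sub n) i → ExactlyOne (lookup B i) → starParity (swapPair i B) ≡ not (starParity B)
starParity-swapPair ((a , b) ∷ᵥ B) zero a≡¬b rewrite a≡¬b = sym (not-distribˡ-xor b (starParity B))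
starParity-swapPair ((a , b) ∷ᵥ B) (suc i) one rewrite starParity-swapPair B i one = sym (not-distribʳ-xor b (starParity B))

del-ins-opp : ∀ (B : Sub n) e → IsTransversal B → e ∉ₛ B → del (ins B e) (opp e) ≡ swapPair (proj₁ e) B
del-ins-opp B e tB e∉B = Sub-ext λ x → case x (pair-cases x e)
  where
  case : ∀ x → x ≡ e ⊎ x ≡ opp e ⊎ proj₁ x ≢ proj₁ e → mem (del (ins B e) (opp e)) x ≡ mem (swapPair (proj₁ e) B) x
  case x (inj₁ refl) = begin
    mem (del (ins B e) (opp e)) e   ≡⟨ mem-setMem-≢ (opp e) e false _ (opp-≢ e) ⟩
    mem (ins B e) e                 ≡⟨ mem-setMem-≡ e true B ⟩
    true                            ≡⟨ ∉⇒opp∈ B e tB e∉B ⟨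
    mem B (opp e)                   ≡⟨ mem-swapPair B (proj₁ e) (proj₂ e) ⟨
    mem (swapPair (proj₁ e) B) e    ∎
    where open ≡-Reasoning
  case x (inj₂ (inj₁ refl)) = begin
    mem (del (ins B e) (opp e)) (opp e)     ≡⟨ mem-setMem-≡ (opp e) false _ ⟩
    false                                   ≡⟨ e∉B ⟨
    mem B e                                 ≡⟨ cong (λ b → mem B (proj₁ e , b)) (not-involutive (proj₂ e)) ⟨
    mem B (opp (opp e))                     ≡⟨ mem-swapPair B (proj₁ e) (not (proj₂ e)) ⟨
    mem (swapPair (proj₁ e) B) (opp e)      ∎
    where open ≡-Reasoning
  case (i , c) (inj₂ (inj₂ i≢p)) = begin
    mem (del (ins B e) (opp e)) (i , c)     ≡⟨ setMem-agree _ (opp e) (i , c) i≢p ⟩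
    mem (ins B e) (i , c)                   ≡⟨ setMem-agree B e (i , c) i≢p ⟩
    mem B (i , c)                           ≡⟨ mem-updateAt-≢ B swap (i , c) i≢p ⟨
    mem (swapPair (proj₁ e) B) (i , c)      ∎
    where open ≡-Reasoning

hyper-parity : ∀ (S : Sub n) (hS : IsHyperTransversal S) σ → Σ Bool λ b → starParity (del S (proj₁ hS , b)) ≡ σ
hyper-parity S hS σ with starParity (del S (proj₁ hS , true)) ≟ᵇ σ
... | yes par = true , par
... | no ¬par = false , (begin
  starParity (del S (p , false))                   ≡⟨ cong (λ X → starParity (del X (p , false))) (hyper-ins-del S hS true) ⟨
  starParity (del (ins B₁ (p , true)) (p , false)) ≡⟨ cong starParity (del-ins-opp B₁ (p , true) tB₁ (mem-setMem-≡ (p , true) false S)) ⟩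
  starParity (swapPair p B₁)                       ≡⟨ starParity-swapPair B₁ p (tB₁ p) ⟩
  not (starParity B₁)                              ≡⟨ cong not (¬-not ¬par) ⟩
  not (not σ)                                      ≡⟨ not-involutive σ ⟩
  σ                                                ∎)
  where
  open ≡-Reasoning
  p : Fin _
  p = proj₁ hS
  B₁ : Sub _
  B₁ = del S (p , true)
  tB₁ : IsTransversal B₁
  tB₁ = del-hyper S hS true

ins-as-setPair : ∀ (X : Sub n) e → opp e ∈ₛ X → ins X e ≡ setPair (proj₁ e) true X
ins-as-setPair X (i , false) oe∈X = updateAt-cong-local i X (cong (true ,_) oe∈X)
ins-as-setPair X (i , true)  oe∈X = updateAt-cong-local i X (cong (_, true) oe∈X)

del-as-setPair : ∀ (X : Sub n) e → opp e ∉ₛ X → del X e ≡ setPair (proj₁ e) false X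
del-as-setPair X (i , false) oe∉X = updateAt-cong-local i X (cong (false ,_) oe∉X)
del-as-setPair X (i , true)  oe∉X = updateAt-cong-local i X (cong (_, false) oe∉X)

-- For S = B ∪ {e} and S′ = B with f replaced by f* and the pair of e emptied, S ∖ S′ = {e, e*, f};
-- the rGP2 terms for x = e, f involve B, B′ (both pairs switched) and the two sets related by rGP4.
module Exchange (B : Sub n) (e f : E n) (tB : IsTransversal B) (e∉B : e ∉ₛ B) (f∈B : f ∈ₛ B) (p≢q : proj₁ e ≢ proj₁ f) where

  private
    p q : Fin n
    p = proj₁ e
    q = proj₁ f
    q≢p : q ≢ p
    q≢p = p≢q ∘ sym

  S′ : Sub n
  S′ = setPair p false (swapPair q B)

  B′ : Sub n
  B′ = swapPair p (swapPair q B)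

  S′-hypo : IsHypoTransversal S′
  S′-hypo = p , lookup∘updateAt p (swapPair q B) ,
            λ i i≢p → subst ExactlyOne (sym (lookup∘updateAt′ i p i≢p (swapPair q B))) (swapPair-transversal B q tB i)

  f∈ins : f ∈ₛ ins B e
  f∈ins = trans (setMem-agree B e f q≢p) f∈B

  f∉S′ : f ∉ₛ S′
  f∉S′ = begin
    mem S′ f                  ≡⟨ mem-updateAt-≢ _ _ f q≢p ⟩
    mem (swapPair q B) f      ≡⟨ mem-swapPair B q (proj₂ f) ⟩
    mem B (opp f)             ≡⟨ ∈⇒opp∉ B f tB f∈B ⟩
    false                     ∎
    where open ≡-Reasoning

  ins∖S′ : ∀ x → x ∈ₛ ins B e → x ∉ₛ S′ → x ≡ e ⊎ x ≡ opp e ⊎ x ≡ f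
  ins∖S′ x x∈S x∉S′ with pair-cases x e
  ... | inj₁ x≡e = inj₁ x≡e
  ... | inj₂ (inj₁ x≡oe) = inj₂ (inj₁ x≡oe)
  ... | inj₂ (inj₂ x≁e) with pair-cases x f
  ...   | inj₁ x≡f = inj₂ (inj₂ x≡f)
  ...   | inj₂ (inj₁ refl) = ⊥-elim (true≢false (begin
    true                       ≡⟨ x∈S ⟨
    mem (ins B e) (opp f)      ≡⟨ setMem-agree B e (opp f) x≁e ⟩
    mem B (opp f)              ≡⟨ ∈⇒opp∉ B f tB f∈B ⟩
    false                      ∎))
    where open ≡-Reasoning
  ...   | inj₂ (inj₂ x≁f) = ⊥-elim (true≢false (begin
    true                       ≡⟨ x∈S ⟨
    mem (ins B e) x            ≡⟨ setMem-agree B e x x≁e ⟩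
    mem B x                    ≡⟨ mem-updateAt-≢ B swap x x≁f ⟨
    mem (swapPair q B) x       ≡⟨ mem-updateAt-≢ _ _ x x≁e ⟨
    mem S′ x                   ≡⟨ x∉S′ ⟩
    false                      ∎))
    where open ≡-Reasoning

  del-ins-f : del (ins B e) f ≡ setPair q false (setPair p true B)
  del-ins-f = begin
    del (ins B e) f                      ≡⟨ cong (λ X → del X f) (ins-as-setPair B e (∉⇒opp∈ B e tB e∉B)) ⟩
    del (setPair p true B) f             ≡⟨ del-as-setPair _ f (trans (mem-updateAt-≢ B _ (opp f) q≢p) (∈⇒opp∉ B f tB f∈B)) ⟩
    setPair q false (setPair p true B)   ∎
    where open ≡-Reasoning

  ins-S′-f : ins S′ f ≡ setPair q true (setPair p false B)
  ins-S′-f = begin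
    ins S′ f                                                ≡⟨ ins-as-setPair S′ f oppf∈S′ ⟩
    setPair q true (setPair p false (swapPair q B))         ≡⟨ cong (setPair q true) (updateAt-commutes p q p≢q B) ⟩
    setPair q true (swapPair q (setPair p false B))         ≡⟨ updateAt-updateAt q (setPair p false B) ⟩
    setPair q true (setPair p false B)                      ∎
    where
    open ≡-Reasoning
    oppf∈S′ : opp f ∈ₛ S′
    oppf∈S′ = begin
      mem S′ (opp f)                  ≡⟨ mem-updateAt-≢ _ _ (opp f) q≢p ⟩
      mem (swapPair q B) (opp f)      ≡⟨ mem-swapPair B q (not (proj₂ f)) ⟩
      mem B (q , not (not (proj₂ f))) ≡⟨ cong (λ c → mem B (q , c)) (not-involutive (proj₂ f)) ⟩
      mem B f                         ≡⟨ f∈B ⟩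
      true                            ∎

  B′-transversal : IsTransversal B′
  B′-transversal = swapPair-transversal (swapPair q B) p (swapPair-transversal B q tB)

  e∈B′ : e ∈ₛ B′
  e∈B′ = begin
    mem B′ e                     ≡⟨ mem-swapPair (swapPair q B) p (proj₂ e) ⟩
    mem (swapPair q B) (opp e)   ≡⟨ mem-updateAt-≢ B swap (opp e) p≢q ⟩
    mem B (opp e)                ≡⟨ ∉⇒opp∈ B e tB e∉B ⟩
    true                         ∎
    where open ≡-Reasoning

  ∈B′ : ∀ x → x ∈ₛ B → proj₁ x ≢ p → x ≢ f → x ∈ₛ B′
  ∈B′ x x∈B x≁e x≢f with pair-cases x f
  ... | inj₁ x≡f = ⊥-elim (x≢f x≡f)
  ... | inj₂ (inj₁ refl) = ⊥-elim (true≢false (trans (sym x∈B) (∈⇒opp∉ B f tB f∈B)))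
  ... | inj₂ (inj₂ x≁f) = begin
    mem B′ x               ≡⟨ mem-updateAt-≢ _ swap x x≁e ⟩
    mem (swapPair q B) x   ≡⟨ mem-updateAt-≢ B swap x x≁f ⟩
    mem B x                ≡⟨ x∈B ⟩
    true                   ∎
    where open ≡-Reasoning

  ins-S′-e : ins S′ e ≡ B′
  ins-S′-e = Sub-ext λ x → case x (pair-cases x e)
    where
    open ≡-Reasoning
    case : ∀ x → x ≡ e ⊎ x ≡ opp e ⊎ proj₁ x ≢ p → mem (ins S′ e) x ≡ mem B′ x
    case x (inj₁ refl) = trans (mem-setMem-≡ e true S′) (sym e∈B′)
    case x (inj₂ (inj₁ refl)) = begin
      mem (ins S′ e) (opp e)   ≡⟨ mem-setMem-≢ e (opp e) true S′ (opp-≢′ e) ⟩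
      mem S′ (opp e)           ≡⟨ mem-setPair _ p false (not (proj₂ e)) ⟩
      false                    ≡⟨ ∈⇒opp∉ B′ e B′-transversal e∈B′ ⟨
      mem B′ (opp e)           ∎
    case x (inj₂ (inj₂ x≁e)) = begin
      mem (ins S′ e) x         ≡⟨ setMem-agree S′ e x x≁e ⟩
      mem S′ x                 ≡⟨ mem-updateAt-≢ _ _ x x≁e ⟩
      mem (swapPair q B) x     ≡⟨ mem-updateAt-≢ _ swap x x≁e ⟨
      mem B′ x                 ∎

-- Cardinality and the family 𝒜_n

length-filterᵇ-map : {A C : Set} (p : C → Bool) (g : A → C) (xs : List A) →
  length (filterᵇ p (map g xs)) ≡ length (filterᵇ (p ∘ g) xs)
length-filterᵇ-map p g [] = refl
length-filterᵇ-map p g (x ∷ xs) with p (g x)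
... | false = length-filterᵇ-map p g xs
... | true  = cong suc (length-filterᵇ-map p g xs)

length-filterᵇ-cong : {A : Set} {p q : A → Bool} → (∀ x → p x ≡ q x) → (xs : List A) →
  length (filterᵇ p xs) ≡ length (filterᵇ q xs)
length-filterᵇ-cong p≗q [] = refl
length-filterᵇ-cong {p = p} {q} p≗q (x ∷ xs) with p x | q x | p≗q x
... | false | .false | refl = length-filterᵇ-cong p≗q xs
... | true  | .true  | refl = cong suc (length-filterᵇ-cong p≗q xs)

cnt : Bool × Bool → ℕ
cnt (false , false) = 0
cnt (false , true)  = 1
cnt (true  , false) = 1
cnt (true  , true)  = 2

card-tail : ∀ x (S : Sub n) → length (filterᵇ (mem (x ∷ᵥ S)) (map sucₑ (allE n))) ≡ card S
card-tail {n} x S = trans (length-filterᵇ-map _ sucₑ (allE n))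
                          (length-filterᵇ-cong (λ { (_ , false) → refl ; (_ , true) → refl }) (allE n))

card-∷ : ∀ x (S : Sub n) → card (x ∷ᵥ S) ≡ cnt x + card S
card-∷ {n} x S = trans (cong (length ∘ filterᵇ (mem (x ∷ᵥ S))) (allE-suc n)) (head x)
  where
  head : ∀ y → length (filterᵇ (mem (y ∷ᵥ S)) ((zero , false) ∷ (zero , true) ∷ map sucₑ (allE n))) ≡ cnt y + card S
  head (false , false) = card-tail (false , false) S
  head (false , true)  = cong (1 +_) (card-tail (false , true) S)
  head (true  , false) = cong (1 +_) (card-tail (true , false) S)
  head (true  , true)  = cong (2 +_) (card-tail (true , true) S)

NoFullPair : Sub n → Set
NoFullPair A = ∀ i → lookup A i ≢ (true , true)

card≤ : ∀ (A : Sub n) → NoFullPair A → card A ≤ n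
card≤ []ᵥ _ = z≤n
card≤ ((false , false) ∷ᵥ A) nf rewrite card-∷ (false , false) A = m≤n⇒m≤1+n (card≤ A (nf ∘ suc))
card≤ ((false , true)  ∷ᵥ A) nf rewrite card-∷ (false , true)  A = s≤s (card≤ A (nf ∘ suc))
card≤ ((true  , false) ∷ᵥ A) nf rewrite card-∷ (true  , false) A = s≤s (card≤ A (nf ∘ suc))
card≤ ((true  , true)  ∷ᵥ A) nf = ⊥-elim (nf zero refl)

card≡⇒transversal : ∀ (A : Sub n) → NoFullPair A → card A ≡ n → IsTransversal A
card≡⇒transversal ((false , false) ∷ᵥ A) nf c rewrite card-∷ (false , false) A = ⊥-elim (1+n≰n (subst (_≤ _) c (card≤ A (nf ∘ suc))))
card≡⇒transversal ((false , true)  ∷ᵥ A) nf c rewrite card-∷ (false , true)  A =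
  λ { zero → refl ; (suc i) → card≡⇒transversal A (nf ∘ suc) (suc-injective c) i }
card≡⇒transversal ((true  , false) ∷ᵥ A) nf c rewrite card-∷ (true  , false) A =
  λ { zero → refl ; (suc i) → card≡⇒transversal A (nf ∘ suc) (suc-injective c) i }
card≡⇒transversal ((true  , true)  ∷ᵥ A) nf c = ⊥-elim (nf zero refl)

suc-card≡⇒hypo : ∀ (A : Sub n) → NoFullPair A → suc (card A) ≡ n → IsHypoTransversal A
suc-card≡⇒hypo ((false , false) ∷ᵥ A) nf c rewrite card-∷ (false , false) A =
  zero , refl , λ { zero 0≢0 → ⊥-elim (0≢0 refl) ; (suc i) _ → card≡⇒transversal A (nf ∘ suc) (suc-injective c) i }
suc-card≡⇒hypo ((false , true) ∷ᵥ A) nf c rewrite card-∷ (false , true) A with suc-card≡⇒hypo A (nf ∘ suc) (suc-injective c)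
... | q , empty , one = suc q , empty , λ { zero _ → refl ; (suc i) i≢q → one i (i≢q ∘ cong suc) }
suc-card≡⇒hypo ((true , false) ∷ᵥ A) nf c rewrite card-∷ (true , false) A with suc-card≡⇒hypo A (nf ∘ suc) (suc-injective c)
... | q , empty , one = suc q , empty , λ { zero _ → refl ; (suc i) i≢q → one i (i≢q ∘ cong suc) }
suc-card≡⇒hypo ((true , true) ∷ᵥ A) nf c = ⊥-elim (nf zero refl)

card-∷-suc : ∀ x {A A′ : Sub n} → card A ≡ suc (card A′) → card (x ∷ᵥ A) ≡ suc (card (x ∷ᵥ A′))
card-∷-suc x {A} {A′} A≡1+A′ = begin
  card (x ∷ᵥ A)               ≡⟨ card-∷ x A ⟩
  cnt x + card A              ≡⟨ cong (cnt x +_) A≡1+A′ ⟩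
  cnt x + suc (card A′)       ≡⟨ +-suc (cnt x) (card A′) ⟩
  suc (cnt x + card A′)       ≡⟨ cong (1 +_) (card-∷ x A′) ⟨
  suc (card (x ∷ᵥ A′))        ∎
  where open ≡-Reasoning

card-del : ∀ (A : Sub n) e → e ∈ₛ A → card A ≡ suc (card (del A e))
card-del ((_ , false) ∷ᵥ A) (zero , false) refl = trans (card-∷ (true , false) A) (cong (1 +_) (sym (card-∷ (false , false) A)))
card-del ((_ , true)  ∷ᵥ A) (zero , false) refl = trans (card-∷ (true , true) A) (cong (1 +_) (sym (card-∷ (false , true) A)))
card-del ((false , _) ∷ᵥ A) (zero , true)  refl = trans (card-∷ (false , true) A) (cong (1 +_) (sym (card-∷ (false , false) A)))
card-del ((true , _)  ∷ᵥ A) (zero , true)  refl = trans (card-∷ (true , true) A) (cong (1 +_) (sym (card-∷ (true , false) A)))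
card-del (x ∷ᵥ A) (suc i , false) e∈A = card-∷-suc x (card-del A (i , false) e∈A)
card-del (x ∷ᵥ A) (suc i , true)  e∈A = card-∷-suc x (card-del A (i , true) e∈A)

-- Deleting i* from the full pair i leaves n − 1 elements and no full pair, so a hypo-transversal;
-- its empty pair q supplies f = q.
InA⇒hyper : ∀ (A : Sub n) → InA A → Σ (E n) λ f → f ∉ₛ A × IsHyperTransversal (ins A f)
InA⇒hyper A (card≡n , j , full , unique) =
  complete (suc-card≡⇒hypo A′ noFull (trans (sym (card-del A (j , true) (cong proj₂ full))) card≡n))
  where
  A′ : Sub _
  A′ = del A (j , true)
  A′j : lookup A′ j ≡ (true , false)
  A′j = trans (lookup∘updateAt j A) (cong (λ s → proj₁ s , false) full)
  noFull : NoFullPair A′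
  noFull i with i ≟ᶠ j
  ... | yes refl = λ eq → true≢false (cong proj₂ (trans (sym eq) A′j))
  ... | no i≢j   = λ eq → i≢j (unique i (trans (sym (lookup∘updateAt′ i j i≢j A)) eq))
  complete : IsHypoTransversal A′ → Σ (E _) λ f → f ∉ₛ A × IsHyperTransversal (ins A f)
  complete (q , empty , one) = (q , false) , cong proj₁ Aq , j , trans (lookup∘updateAt′ j q j≢q A) full , others
    where
    j≢q : j ≢ q
    j≢q refl = true≢false (cong proj₁ (trans (sym A′j) empty))
    Aq : lookup A q ≡ (false , false)
    Aq = trans (sym (lookup∘updateAt′ q j (λ q≡j → j≢q (sym q≡j)) A)) empty
    others : ∀ i → i ≢ j → ExactlyOne (lookup (ins A (q , false)) i)
    others i i≢j with i ≟ᶠ q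
    ... | yes refl = subst ExactlyOne (sym (trans (lookup∘updateAt q A) (cong (λ s → true , proj₂ s) Aq))) refl
    ... | no i≢q   = subst ExactlyOne (sym (trans (lookup∘updateAt′ i q i≢q A) (sym (lookup∘updateAt′ i j i≢j A)))) (one i i≢q)

-- Exhaustive search

any?-Bool : {P : Bool → Set} → (∀ b → Dec (P b)) → Dec (Σ Bool P)
any?-Bool P? = map′ (λ { (inj₁ p) → false , p ; (inj₂ p) → true , p }) (λ { (false , p) → inj₁ p ; (true , p) → inj₂ p })
                    (P? false ⊎-dec P? true)

all?-Bool : {P : Bool → Set} → (∀ b → Dec (P b)) → Dec (∀ b → P b)
all?-Bool P? = map′ (λ { (p , q) false → p ; (p , q) true → q }) (λ h → h false , h true) (P? false ×-dec P? true)

any?ₑ : {P : E n → Set} → (∀ x → Dec (P x)) → Dec (Σ (E n) P)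
any?ₑ P? = map′ (λ { (i , b , p) → (i , b) , p }) (λ { ((i , b) , p) → i , b , p }) (any? λ i → any?-Bool λ b → P? (i , b))

all?ₑ : {P : E n → Set} → (∀ x → Dec (P x)) → Dec (∀ x → P x)
all?ₑ P? = map′ (λ { h (i , b) → h i b }) (λ h i b → h (i , b)) (all? λ i → all?-Bool λ b → P? (i , b))

any?-Sub : {P : Sub n → Set} → (∀ S → Dec (P S)) → Dec (Σ (Sub n) P)
any?-Sub {zero}  P? = map′ ([]ᵥ ,_) (λ { ([]ᵥ , p) → p }) (P? []ᵥ)
any?-Sub {suc n} P? = map′ (λ { (a , b , S , p) → (a , b) ∷ᵥ S , p }) (λ { ((a , b) ∷ᵥ S , p) → a , b , S , p })
                           (any?-Bool λ a → any?-Bool λ b → any?-Sub λ S → P? ((a , b) ∷ᵥ S))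

-- Tracts, formal sums and supports

module _ (T : Tract) where
  open Tract T

  nonzero? : (x : F T) → Dec (x ≢ nothing)
  nonzero? nothing  = no λ x≢0 → x≢0 refl
  nonzero? (just _) = yes λ ()

  is-just⇔≢0 : ∀ {x : F T} → is-just x ≡ true ⇔ x ≢ nothing
  is-just⇔≢0 {nothing} = mk⇔ (λ ()) (λ x≢0 → ⊥-elim (x≢0 refl))
  is-just⇔≢0 {just _}  = mk⇔ (λ _ ()) (λ _ → refl)

  is-just-⊙ : ∀ x y → is-just (_⊙_ T x y) ≡ is-just x ∧ is-just y
  is-just-⊙ nothing  _        = refl
  is-just-⊙ (just _) nothing  = refl
  is-just-⊙ (just _) (just _) = refl

  is-just-sgn : ∀ k → is-just (sgn T k) ≡ true
  is-just-sgn zero    = refl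
  is-just-sgn (suc k) = trans (is-just-⊙ (just minus) (sgn T k)) (is-just-sgn k)

  ⊙-≢0 : ∀ {x y} → x ≢ nothing → y ≢ nothing → _⊙_ T x y ≢ nothing
  ⊙-≢0 {nothing}           x≢0 _   = ⊥-elim (x≢0 refl)
  ⊙-≢0 {just _}  {nothing}  _   y≢0 = ⊥-elim (y≢0 refl)
  ⊙-≢0 {just _}  {just _}   _   _   ()

  ⊙-≡0 : ∀ x y → x ≡ nothing ⊎ y ≡ nothing → _⊙_ T x y ≡ nothing
  ⊙-≡0 nothing  _        _ = refl
  ⊙-≡0 (just _) nothing  _ = refl
  ⊙-≡0 (just _) (just _) (inj₁ ())
  ⊙-≡0 (just _) (just _) (inj₂ ())

  sgn-≢0 : ∀ k → sgn T k ≢ nothing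
  sgn-≢0 k = Equivalence.to is-just⇔≢0 (is-just-sgn k)

  ⊙-identityˡ : ∀ x → _⊙_ T (1F T) x ≡ x
  ⊙-identityˡ nothing  = refl
  ⊙-identityˡ (just x) = cong just (·-idˡ x)

  formalSum-map-filterᵇ : {A : Set} (t : A → F T) (P : A → Bool) (xs : List A) →
    formalSum T (map t (filterᵇ P xs)) ≡ concatMap (λ x → if P x then formalSum T (t x ∷ []) else []) xs
  formalSum-map-filterᵇ t P [] = refl
  formalSum-map-filterᵇ t P (x ∷ xs) with P x
  ... | false = formalSum-map-filterᵇ t P xs
  ... | true with t x
  ...   | nothing = formalSum-map-filterᵇ t P xs
  ...   | just g  = cong (g ∷_) (formalSum-map-filterᵇ t P xs)

  single-term-∉N : (t : E n → F T) (P : E n → Bool) (e : E n) → P e ≡ true → t e ≢ nothing →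
    (∀ x → x ≢ e → P x ≡ true → t x ≡ nothing) → ¬ InN T (map t (filterᵇ P (allE n)))
  single-term-∉N {n} t P e Pe te≢0 others with t e in te
  ... | nothing = ⊥-elim (te≢0 refl)
  ... | just g  = N-unit g ∘ subst N (begin
    formalSum T (map t (filterᵇ P (allE n)))                               ≡⟨ formalSum-map-filterᵇ t P (allE n) ⟩
    concatMap (λ x → if P x then formalSum T (t x ∷ []) else []) (allE n)  ≡⟨ concatMap-allE-single _ e vanish ⟩
    (if P e then formalSum T (t e ∷ []) else [])                           ≡⟨ cong (λ b → if b then formalSum T (t e ∷ []) else []) Pe ⟩
    formalSum T (t e ∷ [])                                                 ≡⟨ cong (λ y → formalSum T (y ∷ [])) te ⟩
    g ∷ []                                                                 ∎)
    where
    open ≡-Reasoning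
    vanish : ∀ x → x ≢ e → (if P x then formalSum T (t x ∷ []) else []) ≡ []
    vanish x x≢e with P x in Px
    ... | false = refl
    ... | true rewrite others x x≢e Px = refl

  support : (E n → F T) → Sub n
  support X = Vec.tabulate λ i → is-just (X (i , false)) , is-just (X (i , true))

  mem-support : ∀ (X : E n → F T) x → mem (support X) x ≡ is-just (X x)
  mem-support X (i , false) = cong proj₁ (lookup∘tabulate _ i)
  mem-support X (i , true)  = cong proj₂ (lookup∘tabulate _ i)

  support-IsSupport : ∀ (X : E n → F T) → IsSupport T X (support X)
  support-IsSupport X x = mk⇔ (λ x∈ → to is-just⇔≢0 (trans (sym (mem-support X x)) x∈))
                              (λ Xx≢0 → trans (mem-support X x) (from is-just⇔≢0 Xx≢0))
    where open Equivalence

  IsSupport⇒≡support : ∀ (X : E n → F T) C → IsSupport T X C → C ≡ support X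
  IsSupport⇒≡support X C C-supp = Sub-ext λ x →
    trans (⇔→≡ (mk⇔ (from is-just⇔≢0 ∘ to (C-supp x)) (from (C-supp x) ∘ to is-just⇔≢0))) (sym (mem-support X x))
    where open Equivalence

  support-scale : ∀ c (X Y : E n → F T) → (∀ x → X x ≡ _⊙_ T (just c) (Y x)) → support X ≡ support Y
  support-scale c X Y X≡cY = Sub-ext λ x → begin
    mem (support X) x                ≡⟨ mem-support X x ⟩
    is-just (X x)                    ≡⟨ cong is-just (X≡cY x) ⟩
    is-just (_⊙_ T (just c) (Y x))   ≡⟨ is-just-⊙ (just c) (Y x) ⟩
    is-just (Y x)                    ≡⟨ mem-support Y x ⟨
    mem (support Y) x                ∎
    where open ≡-Reasoning

-- Restricted Grassmann–Plücker functions

module RestrictedGP (T : Tract) {n : ℕ} (φ : Sub n → F T) (gp : IsRestrictedGP T φ) where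
  open Tract T
  open IsRestrictedGP gp

  σ : Bool
  σ = proj₁ rGP34

  φ-wrong-parity : ∀ B → IsTransversal B → starParity B ≢ σ → φ B ≡ nothing
  φ-wrong-parity = proj₁ (proj₂ rGP34)

  φ-parity : ∀ B → IsTransversal B → φ B ≢ nothing → starParity B ≡ σ
  φ-parity B tB φB≢0 with starParity B ≟ᵇ σ
  ... | yes par = par
  ... | no ¬par = ⊥-elim (φB≢0 (φ-wrong-parity B tB ¬par))

  φ-swapPair : ∀ B i → IsTransversal B → starParity B ≡ σ → φ (swapPair i B) ≡ nothing
  φ-swapPair B i tB par = φ-wrong-parity (swapPair i B) (swapPair-transversal B i tB) λ par′ → not-¬ refl (sym (begin
    not σ                          ≡⟨ cong not par ⟨
    not (starParity B)             ≡⟨ starParity-swapPair B i (tB i) ⟨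
    starParity (swapPair i B)      ≡⟨ par′ ⟩
    σ                              ∎))
    where open ≡-Reasoning

  φ-partner-≢0 : ∀ B → IsTransversal B → starParity B ≡ σ → ∀ i j → i ≢ j →
    φ (setPair j false (setPair i true B)) ≢ nothing → φ (setPair j true (setPair i false B)) ≢ nothing
  φ-partner-≢0 B tB par i j i≢j φ≢0 φ≡0 =
    ⊙-≢0 T (sgn-≢0 T k) φ≢0 (trans (sym (proj₂ (proj₂ rGP34) B tB par i j i≢j)) φ≡0)
    where
    k : ℕ
    k = (if proj₁ (lookup B i) then 1 else 0) + (if proj₁ (lookup B j) then 1 else 0)

  rGP2-single-term : ∀ S S′ → IsHyperTransversal S → IsHypoTransversal S′ → ∀ e → e ∈ₛ S → e ∉ₛ S′ →
    φ (del S e) ≢ nothing → φ (ins S′ e) ≢ nothing →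
    (∀ x → x ≢ e → x ∈ₛ S → x ∉ₛ S′ → φ (del S x) ≡ nothing ⊎ φ (ins S′ x) ≡ nothing) → ⊥
  rGP2-single-term S S′ hS hS′ e e∈S e∉S′ φe≢0 φe′≢0 others =
    single-term-∉N T term P e (cong₂ (λ a b → a ∧ not b) e∈S e∉S′)
                   (⊙-≢0 T (sgn-≢0 T (countBelow (symDiff S S′) e)) (⊙-≢0 T φe≢0 φe′≢0)) vanish (rGP2 S S′ hS hS′)
    where
    term : E n → F T
    term x = _⊙_ T (sgn T (countBelow (symDiff S S′) x)) (_⊙_ T (φ (del S x)) (φ (ins S′ x)))
    P : E n → Bool
    P x = mem S x ∧ not (mem S′ x)
    vanish : ∀ x → x ≢ e → P x ≡ true → term x ≡ nothing
    vanish x x≢e Px with ∧-true Px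
    ... | x∈S , x∉S′ = ⊙-≡0 T _ _ (inj₂ (⊙-≡0 T _ _ (others x x≢e x∈S (trans (sym (not-involutive _)) (cong not x∉S′)))))

  supp : Sub n → Sub n
  supp S = support T (Xvec T φ S)

  mem-supp : ∀ S x → mem (supp S) x ≡ mem S x ∧ is-just (φ (del S x))
  mem-supp S x with mem S x | mem-support T (Xvec T φ S) x
  ... | false | x∈? = x∈?
  ... | true  | x∈? = trans x∈? (trans (is-just-⊙ T (sgn T (countBelow S x)) _) (cong (_∧ is-just (φ (del S x))) (is-just-sgn T (countBelow S x))))

  ∈supp⁺ : ∀ S x → x ∈ₛ S → φ (del S x) ≢ nothing → x ∈ₛ supp S
  ∈supp⁺ S x x∈S φ≢0 = trans (mem-supp S x) (cong₂ _∧_ x∈S (Equivalence.from (is-just⇔≢0 T) φ≢0))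

  ∈supp⁻ : ∀ S x → x ∈ₛ supp S → x ∈ₛ S × φ (del S x) ≢ nothing
  ∈supp⁻ S x x∈Z with ∧-true (trans (sym (mem-supp S x)) x∈Z)
  ... | x∈S , φ≢0 = x∈S , Equivalence.to (is-just⇔≢0 T) φ≢0

  ∉supp : ∀ S x → x ∈ₛ S → x ∉ₛ supp S → φ (del S x) ≡ nothing
  ∉supp S x x∈S x∉Z = is-just≡false (trans (sym (cong (_∧ is-just (φ (del S x))) x∈S)) (trans (sym (mem-supp S x)) x∉Z))

  supp⊈basis : ∀ S → IsHyperTransversal S → ∀ x → x ∈ₛ supp S → ∀ B → IsBasis T φ B → ¬ (supp S ⊆ₛ B)
  supp⊈basis S hS x x∈Z B (tB , φB≢0) Z⊆B =
    rGP2-single-term S (del B x) hS (del-hypo B x tB x∈B) x x∈S (mem-setMem-≡ x false B) φx≢0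
                (subst (λ X → φ X ≢ nothing) (sym (ins-del B x x∈B)) φB≢0) others
    where
    x∈B : x ∈ₛ B
    x∈B = Z⊆B x x∈Z
    x∈S : x ∈ₛ S
    x∈S = proj₁ (∈supp⁻ S x x∈Z)
    φx≢0 : φ (del S x) ≢ nothing
    φx≢0 = proj₂ (∈supp⁻ S x x∈Z)
    others : ∀ y → y ≢ x → y ∈ₛ S → y ∉ₛ del B x → φ (del S y) ≡ nothing ⊎ φ (ins (del B x) y) ≡ nothing
    others y y≢x y∈S y∉B = inj₁ (∉supp S y y∈S (¬-not λ y∈Z →
      true≢false (trans (sym (Z⊆B y y∈Z)) (trans (sym (mem-setMem-≢ x y false B y≢x)) y∉B))))

  exchange : ∀ B e f → IsTransversal B → starParity B ≡ σ → e ∉ₛ B → f ∈ₛ B → proj₁ e ≢ proj₁ f →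
    f ∈ₛ supp (ins B e) → φ B ≢ nothing × φ (swapPair (proj₁ e) (swapPair (proj₁ f) B)) ≢ nothing
  exchange B e f tB par e∉B f∈B p≢q f∈Z =
    (λ φB≡0 → only-f (inj₁ (trans (cong φ (del-ins B e e∉B)) φB≡0))) ,
    (λ φB′≡0 → only-f (inj₂ (trans (cong φ ins-S′-e) φB′≡0)))
    where
    open Exchange B e f tB e∉B f∈B p≢q
    φA₁≢0 : φ (del (ins B e) f) ≢ nothing
    φA₁≢0 = proj₂ (∈supp⁻ _ f f∈Z)
    φA₂≢0 : φ (ins S′ f) ≢ nothing
    φA₂≢0 = subst (λ X → φ X ≢ nothing) (sym ins-S′-f)
              (φ-partner-≢0 B tB par (proj₁ e) (proj₁ f) p≢q (subst (λ X → φ X ≢ nothing) del-ins-f φA₁≢0))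
    only-f : φ (del (ins B e) e) ≡ nothing ⊎ φ (ins S′ e) ≡ nothing → ⊥
    only-f e-vanishes = rGP2-single-term (ins B e) S′ (ins-hyper B e tB e∉B) S′-hypo f f∈ins f∉S′ φA₁≢0 φA₂≢0 others
      where
      others : ∀ x → x ≢ f → x ∈ₛ ins B e → x ∉ₛ S′ → φ (del (ins B e) x) ≡ nothing ⊎ φ (ins S′ x) ≡ nothing
      others x x≢f x∈S x∉S′ with ins∖S′ x x∈S x∉S′
      ... | inj₁ refl          = e-vanishes
      ... | inj₂ (inj₁ refl)   = inj₁ (trans (cong φ (del-ins-opp B e tB e∉B)) (φ-swapPair B (proj₁ e) tB par))
      ... | inj₂ (inj₂ x≡f)    = ⊥-elim (x≢f x≡f)

  -- Z is the fundamental circuit of e over the basis B.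
  module Fundamental (B : Sub n) (e : E n) (bB : IsBasis T φ B) (e∉B : e ∉ₛ B) where

    private
      tB : IsTransversal B
      tB = proj₁ bB
      par : starParity B ≡ σ
      par = φ-parity B tB (proj₂ bB)

    Z : Sub n
    Z = supp (ins B e)

    e∈Z : e ∈ₛ Z
    e∈Z = ∈supp⁺ (ins B e) e (mem-setMem-≡ e true B) (subst (λ X → φ X ≢ nothing) (sym (del-ins B e e∉B)) (proj₂ bB))

    Z-shape : ∀ x → x ∈ₛ Z → x ≡ e ⊎ (proj₁ x ≢ proj₁ e × x ∈ₛ B)
    Z-shape x x∈Z with pair-cases x e
    ... | inj₁ x≡e = inj₁ x≡e
    ... | inj₂ (inj₁ refl) = ⊥-elim (proj₂ (∈supp⁻ _ (opp e) x∈Z)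
                               (trans (cong φ (del-ins-opp B e tB e∉B)) (φ-swapPair B (proj₁ e) tB par)))
    ... | inj₂ (inj₂ x≁e) = inj₂ (x≁e , trans (sym (setMem-agree B e x x≁e)) (proj₁ (∈supp⁻ _ x x∈Z)))

    exchange-basis : ∀ f → f ∈ₛ Z → f ≢ e →
      Σ (Sub n) λ B′ → IsBasis T φ B′ × e ∈ₛ B′ × (∀ x → x ∈ₛ B → proj₁ x ≢ proj₁ e → x ≢ f → x ∈ₛ B′)
    exchange-basis f f∈Z f≢e with Z-shape f f∈Z
    ... | inj₁ f≡e = ⊥-elim (f≢e f≡e)
    ... | inj₂ (f≁e , f∈B) = B′ , (B′-transversal , proj₂ (exchange B e f tB par e∉B f∈B p≢q f∈Z)) , e∈B′ , ∈B′
      where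
      p≢q : proj₁ e ≢ proj₁ f
      p≢q = f≁e ∘ sym
      open Exchange B e f tB e∉B f∈B p≢q

    Z-minus-basis : ∀ f → f ∈ₛ Z → Σ (Sub n) λ B′ → IsBasis T φ B′ × (∀ x → x ∈ₛ Z → x ≢ f → x ∈ₛ B′)
    Z-minus-basis f f∈Z with f ≟ₑ e
    ... | yes refl = B , bB , λ x x∈Z x≢e → [ (λ x≡e → ⊥-elim (x≢e x≡e)) , proj₂ ]′ (Z-shape x x∈Z)
    ... | no f≢e with exchange-basis f f∈Z f≢e
    ...   | B′ , bB′ , e∈B′ , ∈B′ = B′ , bB′ , λ x x∈Z x≢f →
      [ (λ { refl → e∈B′ }) , (λ (x≁e , x∈B) → ∈B′ x x∈B x≁e x≢f) ]′ (Z-shape x x∈Z)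

    isCircuit : IsCircuit (IsBasis T φ) Z
    isCircuit = (swapPair (proj₁ e) B , swapPair-transversal B (proj₁ e) tB , Z⊆swap) ,
                supp⊈basis (ins B e) (ins-hyper B e tB e∉B) e e∈Z ,
                minimal
      where
      Z⊆swap : Z ⊆ₛ swapPair (proj₁ e) B
      Z⊆swap x x∈Z with Z-shape x x∈Z
      ... | inj₁ refl = trans (mem-swapPair B (proj₁ e) (proj₂ e)) (∉⇒opp∈ B e tB e∉B)
      ... | inj₂ (x≁e , x∈B) = trans (mem-updateAt-≢ B swap x x≁e) x∈B
      minimal : ∀ D → D ⊆ₛ Z → D ≢ Z → IsSubtransversal D → ¬ (∀ B₀ → IsBasis T φ B₀ → ¬ (D ⊆ₛ B₀))
      minimal D D⊆Z D≢Z _ indepD = D≢Z (⊆-antisym D⊆Z Z⊆D)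
        where
        Z⊆D : Z ⊆ₛ D
        Z⊆D f f∈Z with mem D f in f∈?D | Z-minus-basis f f∈Z
        ... | true  | _ = refl
        ... | false | B′ , bB′ , Z∖f⊆B′ = ⊥-elim (indepD B′ bB′ λ x x∈D →
                Z∖f⊆B′ x (D⊆Z x x∈D) λ { refl → true≢false (trans (sym x∈D) f∈?D) })

  -- If both S ∖ p and S ∖ p* vanished, the one of parity σ would be a basis by the exchange lemma
  -- applied to any x ∈ supp X_S, which lies outside the pair p.
  hyper-basis : ∀ S (hS : IsHyperTransversal S) x → x ∈ₛ supp S → Σ Bool λ b → IsBasis T φ (del S (proj₁ hS , b))
  hyper-basis S hS x x∈Z with nonzero? T (φ (del S (proj₁ hS , false))) | nonzero? T (φ (del S (proj₁ hS , true)))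
  ... | yes φ₀≢0 | _         = false , del-hyper S hS false , φ₀≢0
  ... | no _     | yes φ₁≢0  = true , del-hyper S hS true , φ₁≢0
  ... | no φ₀≡0  | no φ₁≡0   = ⊥-elim (pair-vanishing λ { false → φ₀≡0 ; true → φ₁≡0 })
    where
    p : Fin n
    p = proj₁ hS
    pair-vanishing : ¬ (∀ b → ¬ (φ (del S (p , b)) ≢ nothing))
    pair-vanishing vanish with proj₁ x ≟ᶠ p | hyper-parity S hS σ
    ... | yes refl | _ = vanish (proj₂ x) (proj₂ (∈supp⁻ S x x∈Z))
    ... | no x≁p | b , par =
      vanish b (proj₁ (exchange B (p , b) x tB par (mem-setMem-≡ (p , b) false S) x∈B (x≁p ∘ sym) x∈Z′))
      where
      B : Sub n
      B = del S (p , b)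
      tB : IsTransversal B
      tB = del-hyper S hS b
      x∈B : x ∈ₛ B
      x∈B = trans (setMem-agree S (p , b) x x≁p) (proj₁ (∈supp⁻ S x x∈Z))
      x∈Z′ : x ∈ₛ supp (ins B (p , b))
      x∈Z′ = subst (λ X → x ∈ₛ supp X) (sym (hyper-ins-del S hS b)) x∈Z

  basis-exists : Σ (Sub n) (IsBasis T φ)
  basis-exists with nonzero
  ... | B , inj₁ tB , φB≢0 = B , tB , φB≢0
  ... | A , inj₂ A∈𝒜 , φA≢0 = from-completion (InA⇒hyper A A∈𝒜)
    where
    from-completion : Σ (E n) (λ f → f ∉ₛ A × IsHyperTransversal (ins A f)) → Σ (Sub n) (IsBasis T φ)
    from-completion (f , f∉A , hS) = _ , proj₂ (hyper-basis (ins A f) hS f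
      (∈supp⁺ (ins A f) f (mem-setMem-≡ f true A) (subst (λ X → φ X ≢ nothing) (sym (del-ins A f f∉A)) φA≢0)))

  supp-nonempty : ∀ S → ¬ (∀ x → Xvec T φ S x ≡ nothing) → Σ (E n) λ x → x ∈ₛ supp S
  supp-nonempty S X≢0 with any?ₑ (λ x → mem (supp S) x ≟ᵇ true)
  ... | yes found = found
  ... | no none = ⊥-elim (X≢0 λ x → is-just≡false (trans (sym (mem-support T (Xvec T φ S) x)) (¬-not λ x∈Z → none (x , x∈Z))))

  circuit-nonempty : ∀ C → IsCircuit (IsBasis T φ) C → Σ (E n) λ e → e ∈ₛ C
  circuit-nonempty C (_ , indep , _) with any?ₑ (λ x → mem C x ≟ᵇ true)
  ... | yes found = found
  ... | no none = ⊥-elim (indep (proj₁ basis-exists) (proj₂ basis-exists) λ x x∈C → ⊥-elim (none (x , x∈C)))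

  -- Minimality of C only refutes that no basis contains C ∖ {e}; a finite search produces one.
  circuit-minus-basis : ∀ C → IsCircuit (IsBasis T φ) C → ∀ e → e ∈ₛ C →
    Σ (Sub n) λ B → IsBasis T φ B × e ∉ₛ B × del C e ⊆ₛ B
  circuit-minus-basis C (subC , indep , minimal) e e∈C = choose (any?-Sub contains-D)
    where
    D : Sub n
    D = del C e
    D⊆C : D ⊆ₛ C
    D⊆C x x∈D with x ≟ₑ e
    ... | yes refl = ⊥-elim (true≢false (trans (sym x∈D) (mem-setMem-≡ e false C)))
    ... | no x≢e   = trans (sym (mem-setMem-≢ e x false C x≢e)) x∈D
    D≢C : D ≢ C
    D≢C D≡C = true≢false (trans (sym e∈C) (trans (cong (λ X → mem X e) (sym D≡C)) (mem-setMem-≡ e false C)))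
    subD : IsSubtransversal D
    subD = proj₁ subC , proj₁ (proj₂ subC) , λ x x∈D → proj₂ (proj₂ subC) x (D⊆C x x∈D)
    contains-D : ∀ B → Dec (IsBasis T φ B × D ⊆ₛ B)
    contains-D B = ((all? λ i → proj₁ (lookup B i) ≟ᵇ not (proj₂ (lookup B i))) ×-dec nonzero? T (φ B))
                   ×-dec all?ₑ (λ x → (mem D x ≟ᵇ true) →-dec (mem B x ≟ᵇ true))
    C⊆B : ∀ B → D ⊆ₛ B → e ∈ₛ B → C ⊆ₛ B
    C⊆B B D⊆B e∈B x x∈C with x ≟ₑ e
    ... | yes refl = e∈B
    ... | no x≢e   = D⊆B x (trans (mem-setMem-≢ e x false C x≢e) x∈C)
    choose : Dec (Σ (Sub n) λ B → IsBasis T φ B × D ⊆ₛ B) → Σ (Sub n) λ B → IsBasis T φ B × e ∉ₛ B × D ⊆ₛ B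
    choose (no none) = ⊥-elim (minimal D D⊆C D≢C subD λ B bB D⊆B → none (B , bB , D⊆B))
    choose (yes (B , bB , D⊆B)) = B , bB , ¬-not (λ e∈B → indep B bB (C⊆B B D⊆B e∈B)) , D⊆B

  circuit-is-fundamental : ∀ C B e → IsCircuit (IsBasis T φ) C → (bB : IsBasis T φ B) → e ∈ₛ C → (e∉B : e ∉ₛ B) →
    del C e ⊆ₛ B → C ≡ Fundamental.Z B e bB e∉B
  circuit-is-fundamental C B e (subC , indep , minimal) bB e∈C e∉B D⊆B = ⊆-antisym C⊆Z Z⊆C
    where
    open Fundamental B e bB e∉B
    Z⊆C : Z ⊆ₛ C
    Z⊆C y y∈Z with mem C y in y∈?C
    ... | true  = refl
    ... | false = ⊥-elim (avoid (exchange-basis y y∈Z λ { refl → true≢false (trans (sym e∈C) y∈?C) }))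
      where
      avoid : Σ (Sub n) (λ B′ → IsBasis T φ B′ × e ∈ₛ B′ × (∀ x → x ∈ₛ B → proj₁ x ≢ proj₁ e → x ≢ y → x ∈ₛ B′)) →
              ⊥
      avoid (B′ , bB′ , e∈B′ , ∈B′) = indep B′ bB′ C⊆B′
        where
        C⊆B′ : C ⊆ₛ B′
        C⊆B′ x x∈C with pair-cases x e
        ... | inj₁ refl        = e∈B′
        ... | inj₂ (inj₁ refl) = ⊥-elim (true≢false (trans (sym x∈C) (subtransversal-opp C e subC e∈C)))
        ... | inj₂ (inj₂ x≁e)  = ∈B′ x (D⊆B x (trans (setMem-agree C e x x≁e) x∈C)) x≁e
                                     λ { refl → true≢false (trans (sym x∈C) y∈?C) }
    C⊆Z : C ⊆ₛ Z
    C⊆Z y y∈C with mem Z y in y∈?Z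
    ... | true  = refl
    ... | false = ⊥-elim (minimal Z Z⊆C Z≢C (proj₁ isCircuit) (proj₁ (proj₂ isCircuit)))
      where
      Z≢C : Z ≢ C
      Z≢C Z≡C = true≢false (trans (sym y∈C) (trans (cong (λ X → mem X y) (sym Z≡C)) y∈?Z))

  vector⇒circuit : ∀ C → Σ (E n → F T) (λ X → InCircuitSet T φ X × IsSupport T X C) → IsCircuit (IsBasis T φ) C
  vector⇒circuit C (X , (c , S , hS , X≢0 , X≡cXS) , C-supp) =
    subst (IsCircuit (IsBasis T φ)) (sym C≡Z) (Fundamental.isCircuit B e (proj₂ basis) (mem-setMem-≡ e false S))
    where
    basis : Σ Bool λ b → IsBasis T φ (del S (proj₁ hS , b))
    basis = hyper-basis S hS (proj₁ (supp-nonempty S X≢0)) (proj₂ (supp-nonempty S X≢0))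
    e : E n
    e = proj₁ hS , proj₁ basis
    B : Sub n
    B = del S e
    C≡Z : C ≡ supp (ins B e)
    C≡Z = begin
      C                        ≡⟨ IsSupport⇒≡support T X C C-supp ⟩
      support T X              ≡⟨ support-scale T c X (Xvec T φ S) X≡cXS ⟩
      supp S                   ≡⟨ cong supp (hyper-ins-del S hS (proj₁ basis)) ⟨
      supp (ins B e)           ∎
      where open ≡-Reasoning

  circuit⇒vector : ∀ C → IsCircuit (IsBasis T φ) C → Σ (E n → F T) (λ X → InCircuitSet T φ X × IsSupport T X C)
  circuit⇒vector C circ with circuit-nonempty C circ
  ... | e , e∈C with circuit-minus-basis C circ e e∈C
  ...   | B , bB , e∉B , D⊆B =
    Xvec T φ (ins B e) ,
    (one , ins B e , ins-hyper B e (proj₁ bB) e∉B , X≢0 , λ x → sym (⊙-identityˡ T (Xvec T φ (ins B e) x))) ,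
    subst (IsSupport T (Xvec T φ (ins B e))) (sym (circuit-is-fundamental C B e circ bB e∈C e∉B D⊆B))
          (support-IsSupport T (Xvec T φ (ins B e)))
    where
    X≢0 : ¬ (∀ x → Xvec T φ (ins B e) x ≡ nothing)
    X≢0 all0 = Equivalence.to (support-IsSupport T (Xvec T φ (ins B e)) e) (Fundamental.e∈Z B e bB e∉B) (all0 e)

lemma3p25 : (T : Tract) (n : ℕ) (φ : Sub n → F T) → IsRestrictedGP T φ →
    ∀ (C : Sub n) → IsCircuit (IsBasis T φ) C ⇔ Σ (E n → F T) (λ X → InCircuitSet T φ X × IsSupport T X C)
lemma3p25 T n φ gp C = mk⇔ (circuit⇒vector C) (vector⇒circuit C)
  where open RestrictedGP T φ gp
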